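{- Let $\mathcal B$ be a category with chosen local terminal objects and let $p\colon\mathcal E\to\mathcal B$ be a discrete opfibration. Let $\mathcal B_{\mathrm{lt}}\subseteq\mathcal B$ be the set of chosen local terminal objects and $\mathrm{Fib}_{\mathcal B_{\mathrm{lt}}}(p)$ the pullback of $p$ along $\mathcal B_{\mathrm{lt}}\hookrightarrow\mathcal B$, i.e. the set of objects of $\mathcal E$ lying over chosen local terminal objects of $\mathcal B$. Then the objects of $\mathrm{Fib}_{\mathcal B_{\mathrm{lt}}}(p)$ equip $\mathcal E$ with chosen local terminal objects (each connected component of $\mathcal E$ contains exactly one of them, and it is terminal in that component).
   Context: A category has chosen local terminal objects if in each connected component a terminal object of that component is chosen. A functor $p\colon\mathcal E\to\mathcal B$ is a discrete opfibration if for every object $x\in\mathcal E$ and every morphism $f\colon p(x)\to y$ in $\mathcal B$ there is a unique morphism in $\mathcal E$ with domain $x$ mapping to $f$. -}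

module Defs where

open import Level using (Level; _⊔_) renaming (suc to lsuc)
open import Data.Product using (Σ; _×_; _,_)
open import Relation.Binary.PropositionalEquality using (_≡_; subst)

record Category (o ℓ : Level) : Set (lsuc (o ⊔ ℓ)) where
  infixr 9 _∘_
  field
    Obj       : Set o
    _⇒_       : Obj → Obj → Set ℓ
    id        : ∀ {A} → A ⇒ A
    _∘_       : ∀ {A B C} → B ⇒ C → A ⇒ B → A ⇒ C
    identityˡ : ∀ {A B} {f : A ⇒ B} → id ∘ f ≡ f
    identityʳ : ∀ {A B} {f : A ⇒ B} → f ∘ id ≡ f
    assoc     : ∀ {A B C D} {f : A ⇒ B} {g : B ⇒ C} {h : C ⇒ D} →
                (h ∘ g) ∘ f ≡ h ∘ (g ∘ f)

record Functor {o ℓ o' ℓ'} (C : Category o ℓ) (D : Category o' ℓ')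
       : Set (o ⊔ ℓ ⊔ o' ⊔ ℓ') where
  private
    module C = Category C
    module D = Category D
  field
    F₀           : C.Obj → D.Obj
    F₁           : ∀ {A B} → A C.⇒ B → F₀ A D.⇒ F₀ B
    identity     : ∀ {A} → F₁ (C.id {A}) ≡ D.id
    homomorphism : ∀ {A B E} {f : A C.⇒ B} {g : B C.⇒ E} →
                   F₁ (g C.∘ f) ≡ F₁ g D.∘ F₁ f

module _ {o ℓ} (C : Category o ℓ) where
  open Category C

  -- zigzags of morphisms; y lies in the connected component of x iff Zigzag x y
  data Zigzag (x : Obj) : Obj → Set (o ⊔ ℓ) where
    here : Zigzag x x
    fwd  : ∀ {y z} → Zigzag x y → y ⇒ z → Zigzag x z
    bwd  : ∀ {y z} → Zigzag x y → z ⇒ y → Zigzag x z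

  IsTerminalInComponent : Obj → Set (o ⊔ ℓ)
  IsTerminalInComponent t =
    ∀ y → Zigzag t y → Σ (y ⇒ t) λ f → ∀ (g : y ⇒ t) → g ≡ f

  IsChosenLocalTerminals : ∀ {q} → (Obj → Set q) → Set (o ⊔ ℓ ⊔ q)
  IsChosenLocalTerminals P =
    ∀ x → Σ Obj λ t →
      P t × Zigzag x t
      × (∀ t' → P t' → Zigzag x t' → t' ≡ t)
      × IsTerminalInComponent t

module _ {o ℓ o' ℓ'} {E : Category o ℓ} {B : Category o' ℓ'} where
  private
    module E = Category E
    module B = Category B

  Lift : (p : Functor E B) (x : E.Obj) {y : B.Obj} →
         Functor.F₀ p x B.⇒ y → Set (o ⊔ ℓ ⊔ o' ⊔ ℓ')
  Lift p x {y} f = Σ E.Obj λ x' → Σ (x E.⇒ x') λ g →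
                   Σ (F₀ x' ≡ y) λ eq → subst (F₀ x B.⇒_) eq (F₁ g) ≡ f
    where open Functor p

  IsDiscreteOpfibration : Functor E B → Set (o ⊔ ℓ ⊔ o' ⊔ ℓ')
  IsDiscreteOpfibration p =
    ∀ x {y} (f : Functor.F₀ p x B.⇒ y) →
      Lift p x f
      × (∀ (l₁ l₂ : Lift p x f) →
           Σ (Σ.proj₁ l₁ ≡ Σ.proj₁ l₂) λ e →
             subst (x E.⇒_) e (Σ.proj₁ (Σ.proj₂ l₁)) ≡ Σ.proj₁ (Σ.proj₂ l₂))

{-# OPTIONS --safe #-}
-- Fix x in E and let t₀ be the chosen local terminal object in the component
-- of p x.  All objects y in the component of x have an essentially unique map
-- p y → t₀, and the codomain of its lift is the same object t for every y:
-- it is preserved along each edge of a zigzag because lifts compose and are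
-- unique.  So t lies over t₀, is the only object of the component over a
-- chosen object (such an object is the codomain of the lift of its own
-- identity), and the lifts y → t are the unique maps into t.
module Submission where

open import Defs
open import Data.Product using (_,_; proj₁; proj₂)
open import Relation.Binary.PropositionalEquality
open import Axiom.UniquenessOfIdentityProofs.WithK using (uip)

module _ {o ℓ} (C : Category o ℓ) where
  open Category C

  Zigzag-trans : ∀ {a b c} → Zigzag C a b → Zigzag C b c → Zigzag C a c
  Zigzag-trans z here      = z
  Zigzag-trans z (fwd w h) = fwd (Zigzag-trans z w) h
  Zigzag-trans z (bwd w h) = bwd (Zigzag-trans z w) h

  Zigzag-sym : ∀ {a b} → Zigzag C a b → Zigzag C b a
  Zigzag-sym here      = here
  Zigzag-sym (fwd z h) = Zigzag-trans (bwd here h) (Zigzag-sym z)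
  Zigzag-sym (bwd z h) = Zigzag-trans (fwd here h) (Zigzag-sym z)

  terminalInComponent-unique : ∀ {t y} → IsTerminalInComponent C t → Zigzag C t y →
                               (f g : y ⇒ t) → f ≡ g
  terminalInComponent-unique term c f g =
    trans (proj₂ (term _ c) f) (sym (proj₂ (term _ c) g))

module _ {o ℓ o' ℓ'} {C : Category o ℓ} {D : Category o' ℓ'} (F : Functor C D) where
  open Functor F

  Zigzag-map : ∀ {a b} → Zigzag C a b → Zigzag D (F₀ a) (F₀ b)
  Zigzag-map here      = here
  Zigzag-map (fwd z h) = fwd (Zigzag-map z) (F₁ h)
  Zigzag-map (bwd z h) = bwd (Zigzag-map z) (F₁ h)

module DiscreteOpfibration {o ℓ o' ℓ'} {E : Category o ℓ} {B : Category o' ℓ'}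
                           (p : Functor E B) (dof : IsDiscreteOpfibration p) where
  private
    module E = Category E
    module B = Category B
  open Functor p

  lift : ∀ x {b} (f : F₀ x B.⇒ b) → Lift p x f
  lift x f = proj₁ (dof x f)

  liftObj : ∀ x {b} → F₀ x B.⇒ b → E.Obj
  liftObj x f = proj₁ (lift x f)

  liftObj-unique : ∀ {x b} {f : F₀ x B.⇒ b} (l : Lift p x f) → liftObj x f ≡ proj₁ l
  liftObj-unique l = proj₁ (proj₂ (dof _ _) (lift _ _) l)

  Lift-arrow-unique : ∀ {x b} {f : F₀ x B.⇒ b} (l₁ l₂ : Lift p x f)
                      (e : proj₁ l₁ ≡ proj₁ l₂) →
                      subst (x E.⇒_) e (proj₁ (proj₂ l₁)) ≡ proj₁ (proj₂ l₂)
  Lift-arrow-unique {x} l₁ l₂ e with proj₂ (dof _ _) l₁ l₂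
  ... | e′ , s = trans (cong (λ e → subst (x E.⇒_) e (proj₁ (proj₂ l₁))) (uip e e′)) s

  Lift-∘ʳ : ∀ {x y b} {f : F₀ y B.⇒ b} (h : x E.⇒ y) → Lift p y f → Lift p x (f B.∘ F₁ h)
  Lift-∘ʳ {x} h (y′ , g , e , lifts) = y′ , g E.∘ h , e , over e lifts
    where
      over : ∀ {b f} (e : F₀ y′ ≡ b) → subst (F₀ _ B.⇒_) e (F₁ g) ≡ f →
             subst (F₀ x B.⇒_) e (F₁ (g E.∘ h)) ≡ f B.∘ F₁ h
      over refl refl = homomorphism

  liftObj-∘ʳ : ∀ {x y b} (h : x E.⇒ y) (f : F₀ y B.⇒ b) →
               liftObj x (f B.∘ F₁ h) ≡ liftObj y f
  liftObj-∘ʳ h f = liftObj-unique (Lift-∘ʳ h (lift _ f))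

  liftObj-id : ∀ {y b} (e : F₀ y ≡ b) → liftObj y (subst (F₀ y B.⇒_) e (F₁ E.id)) ≡ y
  liftObj-id e = liftObj-unique (_ , E.id , e , refl)

  module OverLocalTerminal {t₀ : B.Obj} (term₀ : IsTerminalInComponent B t₀)
                           {x : E.Obj} (cx : Zigzag B t₀ (F₀ x)) where

    overComponent : ∀ {y} → Zigzag E x y → Zigzag B t₀ (F₀ y)
    overComponent c = Zigzag-trans B cx (Zigzag-map p c)

    ! : ∀ {y} → Zigzag E x y → F₀ y B.⇒ t₀
    ! c = proj₁ (term₀ _ (overComponent c))

    !-unique : ∀ {y} → Zigzag E x y → (f g : F₀ y B.⇒ t₀) → f ≡ g
    !-unique c = terminalInComponent-unique B term₀ (overComponent c)

    liftObj-constant : ∀ {y} → Zigzag E x y → (f : F₀ x B.⇒ t₀) (g : F₀ y B.⇒ t₀) →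
                       liftObj x f ≡ liftObj y g
    liftObj-constant here f g = cong (liftObj x) (!-unique here f g)
    liftObj-constant (fwd c h) f g =
      trans (liftObj-constant c f (g B.∘ F₁ h)) (liftObj-∘ʳ h g)
    liftObj-constant {z} (bwd c h) f g = trans (liftObj-constant c f (! c)) (begin
      liftObj _ (! c)             ≡⟨ liftObj-∘ʳ h (! c) ⟨
      liftObj z (! c B.∘ F₁ h)    ≡⟨ cong (liftObj z) (!-unique (bwd c h) _ g) ⟩
      liftObj z g                 ∎)
      where open ≡-Reasoning

    centre : E.Obj
    centre = liftObj x (! here)

    toCentre : x E.⇒ centre
    toCentre = proj₁ (proj₂ (lift x (! here)))

    centre-over : F₀ centre ≡ t₀
    centre-over = proj₁ (proj₂ (proj₂ (lift x (! here))))

    centre-unique : ∀ t → F₀ t ≡ t₀ → Zigzag E x t → t ≡ centre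
    centre-unique t e c =
      sym (trans (liftObj-constant c (! here) _) (liftObj-id e))

    centre-terminal : IsTerminalInComponent E centre
    centre-terminal y cy = subst (y E.⇒_) e arrow , unique
      where
        cxy : Zigzag E x y
        cxy = Zigzag-trans E (fwd here toCentre) cy

        arrow : y E.⇒ liftObj y (! cxy)
        arrow = proj₁ (proj₂ (lift y (! cxy)))

        e : liftObj y (! cxy) ≡ centre
        e = sym (liftObj-constant cxy (! here) (! cxy))

        unique : ∀ k → k ≡ subst (y E.⇒_) e arrow
        unique k = sym (Lift-arrow-unique (lift y (! cxy)) k-lifts e)
          where
            k-lifts : Lift p y (! cxy)
            k-lifts = centre , k , centre-over , !-unique cxy _ _

lemma8p2 : ∀ {o ℓ o' ℓ' q} (B : Category o' ℓ') (P : Category.Obj B → Set q)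
    → IsChosenLocalTerminals B P
    → (E : Category o ℓ) (p : Functor E B) → IsDiscreteOpfibration p
    → IsChosenLocalTerminals E (λ e → P (Functor.F₀ p e))
lemma8p2 B P cl E p dof x with cl (Functor.F₀ p x)
... | t₀ , Pt₀ , x⇝t₀ , t₀-unique , term₀ =
  centre , subst P (sym centre-over) Pt₀ , fwd here toCentre ,
  (λ t Pt x⇝t → centre-unique t (t₀-unique _ Pt (Zigzag-map p x⇝t)) x⇝t) ,
  centre-terminal
  where
    open DiscreteOpfibration p dof
    open OverLocalTerminal term₀ (Zigzag-sym B x⇝t₀)
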